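{- Every graph $G$ admits a biarithmetic IASI.
   Context: All graphs are simple and finite with no isolated vertices. Let $\mathbb{N}_0$ be the set of non-negative integers and $\mathcal{P}(\mathbb{N}_0)$ its power set; label sets are finite and non-empty. For sets $A,B$, $A+B=\{a+b: a\in A, b\in B\}$. An integer additive set-indexer (IASI) of $G$ is an injective map $f:V(G)\to\mathcal{P}(\mathbb{N}_0)$ such that $f^+:E(G)\to\mathcal{P}(\mathbb{N}_0)$, $f^+(uv)=f(u)+f(v)$, is also injective. An AP-set is a finite set of integers with at least three elements forming an arithmetic progression; its common difference is the deterministic index of the element it labels. An IASI is arithmetic if all vertex labels $f(v)$ and edge labels $f^+(e)$ are AP-sets. The deterministic ratio of an edge is the ratio ($\ge 1$) of the larger to the smaller deterministic index of its end vertices. A biarithmetic IASI is an arithmetic IASI $f$ such that for every edge $uv$, writing $d_u\le d_v$ for the deterministic indices of its ends, $d_v=k\,d_u$ for some integer $k$ with $1<k\le |f(u)|$. -}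

module Defs where

open import Data.Nat using (ℕ; _+_; _*_; _≤_; _<_)
open import Data.Fin using (Fin)
open import Data.List using (List; cartesianProductWith)
open import Data.List.Membership.Propositional using (_∈_)
open import Data.Product using (Σ; ∃; ∃-syntax; _×_; _,_)
open import Data.Sum using (_⊎_)
open import Data.Empty using (⊥)
open import Relation.Binary.PropositionalEquality using (_≡_)
open import Function.Bundles using (_⇔_)

record Graph : Set₁ where
  field
    n     : ℕ
    Adj   : Fin n → Fin n → Set
    sym   : ∀ {u v} → Adj u v → Adj v u
    irrefl : ∀ {u} → Adj u u → ⊥

open Graph public

NoIsolated : Graph → Set
NoIsolated G = ∀ (v : Fin (n G)) → ∃[ u ] Adj G v u

-- Finite subsets of ℕ are represented by lists; set equality is extensional.
FinSet : Set
FinSet = List ℕ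

_≐_ : FinSet → FinSet → Set
A ≐ B = ∀ x → (x ∈ A) ⇔ (x ∈ B)

_⊕_ : FinSet → FinSet → FinSet
A ⊕ B = cartesianProductWith _+_ A B

-- An AP-set: S = {a, a+d, ..., a+(k-1)d} with k ≥ 3 elements and d ≥ 1.
-- (start, diff, len) are uniquely determined by S; diff is the deterministic
-- index and len = |S|.
record APSet (S : FinSet) : Set where
  field
    start : ℕ
    diff  : ℕ
    len   : ℕ
    diff≥1 : 1 ≤ diff
    len≥3  : 3 ≤ len
    spec   : ∀ x → (x ∈ S) ⇔ (∃[ i ] (i < len × x ≡ start + i * diff))

open APSet public

-- Integer additive set-indexer: injective vertex labelling (finite nonempty
-- sets) with injective induced edge labelling f⁺(uv) = f u + f v.
record IsIASI (G : Graph) (f : Fin (n G) → FinSet) : Set where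
  field
    nonempty : ∀ v → ∃[ x ] (x ∈ f v)
    vinj : ∀ u v → f u ≐ f v → u ≡ v
    einj : ∀ u v x y → Adj G u v → Adj G x y →
           (f u ⊕ f v) ≐ (f x ⊕ f y) →
           (u ≡ x × v ≡ y) ⊎ (u ≡ y × v ≡ x)

RatioOK : ∀ {A B : FinSet} → APSet A → APSet B → Set
RatioOK pu pv = ∃[ k ] (1 < k × k ≤ len pu × diff pv ≡ k * diff pu)

record IsBiarithmeticIASI (G : Graph) (f : Fin (n G) → FinSet) : Set where
  field
    iasi   : IsIASI G f
    vAP    : ∀ v → APSet (f v)
    eAP    : ∀ u v → Adj G u v → APSet (f u ⊕ f v)
    ratio  : ∀ u v → Adj G u v → RatioOK (vAP u) (vAP v) ⊎ RatioOK (vAP v) (vAP u)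

-- Give vertex v the AP with first term v and common difference 2 ^ v, all
-- labels having one length L > 2 ^ n.  For u < v the difference 2 ^ v is
-- 2 ^ (v ∸ u) * 2 ^ u with 2 ^ (v ∸ u) ≤ L, so the steps of the second label
-- are bridged by the L consecutive terms of the first: the sumset is again an
-- AP, with first term u + v and difference 2 ^ u.  An AP-set determines its
-- first term and difference, so an edge label determines u + v and min u v,
-- hence the edge; and the ratio 2 ^ (v ∸ u) lies in (1, L].
module Submission where

open import Defs hiding (sym)
open import Data.Nat using (ℕ; zero; suc; _+_; _*_; _∸_; _^_; _⊓_; ∣_-_∣; _≤_; _<_; _≤?_; z≤n; s≤s)
open import Data.Nat.Properties
open import Data.Nat.Solver using (module +-*-Solver)
open import Data.Fin using (Fin; toℕ)
open import Data.Fin.Properties using (toℕ-injective; toℕ<n)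
open import Data.List using (map; upTo)
open import Data.List.Membership.Propositional using (_∈_)
open import Data.List.Membership.Propositional.Properties
  using (∈-map⁺; ∈-map⁻; ∈-upTo⁺; ∈-upTo⁻; ∈-cartesianProductWith⁺; ∈-cartesianProductWith⁻)
open import Data.Product as × using (∃-syntax; ∃₂; _×_; _,_)
open import Data.Sum as ⊎ using (_⊎_; inj₁; inj₂)
open import Relation.Binary using (tri<; tri≈; tri>)
open import Relation.Nullary using (yes; no; contradiction)
open import Relation.Binary.PropositionalEquality
  using (_≡_; _≢_; refl; sym; trans; cong; subst; module ≡-Reasoning)
open import Function.Base using (_∘_)
open import Function.Bundles using (_⇔_; mk⇔; Equivalence)
import Function.Properties.Equivalence as ⇔

open Equivalence using (to; from)
open +-*-Solver using (solve; _:+_; _:*_; _:=_)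

≐-sym : ∀ {A B} → A ≐ B → B ≐ A
≐-sym A≐B x = ⇔.sym (A≐B x)

≐-trans : ∀ {A B C} → A ≐ B → B ≐ C → A ≐ C
≐-trans A≐B B≐C x = ⇔.trans (A≐B x) (B≐C x)

∈-⊕ : ∀ A B {x} → x ∈ A ⊕ B ⇔ (∃₂ λ y z → y ∈ A × z ∈ B × x ≡ y + z)
∈-⊕ A B = mk⇔ (∈-cartesianProductWith⁻ _+_ A B)
               (λ { (y , z , y∈A , z∈B , refl) → ∈-cartesianProductWith⁺ _+_ y∈A z∈B })

⊕-comm : ∀ A B → (A ⊕ B) ≐ (B ⊕ A)
⊕-comm A B x = mk⇔ (swap A B) (swap B A)
  where
    swap : ∀ A B → x ∈ A ⊕ B → x ∈ B ⊕ A
    swap A B x∈ with y , z , y∈A , z∈B , refl ← to (∈-⊕ A B) x∈ =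
      from (∈-⊕ B A) (z , y , z∈B , y∈A , +-comm y z)

ap : ℕ → ℕ → ℕ → FinSet
ap a d k = map (λ i → a + i * d) (upTo k)

∈-ap : ∀ a d k {x} → x ∈ ap a d k ⇔ (∃[ i ] (i < k × x ≡ a + i * d))
∈-ap a d k = mk⇔ (λ x∈ → let i , i∈ , x≡ = ∈-map⁻ _ x∈ in i , ∈-upTo⁻ i∈ , x≡)
                 (λ { (i , i<k , refl) → ∈-map⁺ (λ i → a + i * d) (∈-upTo⁺ i<k) })

APSet-ap : ∀ {a d k} → 1 ≤ d → 3 ≤ k → APSet (ap a d k)
APSet-ap {a} {d} {k} 1≤d 3≤k = record
  { start = a ; diff = d ; len = k ; diff≥1 = 1≤d ; len≥3 = 3≤k ; spec = λ _ → ∈-ap a d k }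

APSet-≐ : ∀ {S T} → S ≐ T → APSet T → APSet S
APSet-≐ S≐T B = record
  { start = start B ; diff = diff B ; len = len B ; diff≥1 = diff≥1 B ; len≥3 = len≥3 B
  ; spec = λ x → ⇔.trans (S≐T x) (spec B x) }

module _ {S : FinSet} (A : APSet S) where

  ∈-index : ∀ {i} → i < len A → start A + i * diff A ∈ S
  ∈-index i<len = from (spec A _) (_ , i<len , refl)

  start-∈ : start A ∈ S
  start-∈ = subst (_∈ S) (+-identityʳ (start A)) (∈-index (≤-trans (s≤s z≤n) (len≥3 A)))

  next-∈ : start A + diff A ∈ S
  next-∈ = subst (λ d → start A + d ∈ S) (*-identityˡ (diff A))
                 (∈-index (≤-trans (s≤s (s≤s z≤n)) (len≥3 A)))

  ∈⇒≡start⊎next≤ : ∀ {x} → x ∈ S → x ≡ start A ⊎ start A + diff A ≤ x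
  ∈⇒≡start⊎next≤ x∈S with to (spec A _) x∈S
  ... | zero  , _ , refl = inj₁ (+-identityʳ (start A))
  ... | suc i , _ , refl = inj₂ (+-monoʳ-≤ (start A) (m≤m+n (diff A) (i * diff A)))

  start-≤ : ∀ {x} → x ∈ S → start A ≤ x
  start-≤ x∈S with ∈⇒≡start⊎next≤ x∈S
  ... | inj₁ refl = ≤-refl
  ... | inj₂ next≤x = m+n≤o⇒m≤o (start A) next≤x

module _ {S T : FinSet} (A : APSet S) (B : APSet T) (S≐T : S ≐ T) where

  start-unique : start A ≡ start B
  start-unique = ≤-antisym (start-≤ A (from (S≐T _) (start-∈ B)))
                           (start-≤ B (to (S≐T _) (start-∈ A)))

  next-≤ : start B + diff B ≤ start A + diff A
  next-≤ with ∈⇒≡start⊎next≤ B (to (S≐T _) (next-∈ A))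
  ... | inj₁ next≡start = contradiction (trans next≡start (sym start-unique))
                            (>⇒≢ (m<m+n (start A) (diff≥1 A)))
  ... | inj₂ next≤next = next≤next

diff-unique : ∀ {S T} (A : APSet S) (B : APSet T) → S ≐ T → diff A ≡ diff B
diff-unique A B S≐T = +-cancelˡ-≡ (start A) _ _ (begin
  start A + diff A  ≡⟨ ≤-antisym (next-≤ B A (≐-sym S≐T)) (next-≤ A B S≐T) ⟩
  start B + diff B  ≡⟨ cong (_+ diff B) (start-unique B A (≐-sym S≐T)) ⟩
  start A + diff B  ∎)
  where open ≡-Reasoning

decompose : ∀ {k m} l i → m ≤ suc k → i ≤ k + l * m →
            ∃₂ λ s t → s ≤ k × t ≤ l × i ≡ s + t * m
decompose zero i _ i≤k+0 = i , 0 , subst (i ≤_) (+-identityʳ _) i≤k+0 , z≤n , sym (+-identityʳ i)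
decompose {k} {m} (suc l) i m≤1+k i≤ with i ≤? k
... | yes i≤k = i , 0 , i≤k , z≤n , sym (+-identityʳ i)
... | no i≰k =
  let s , t , s≤k , t≤l , i∸m≡ = decompose l (i ∸ m) m≤1+k i∸m≤k+l*m
  in s , suc t , s≤k , s≤s t≤l , (begin
       i              ≡⟨ sym (m∸n+n≡m m≤i) ⟩
       i ∸ m + m      ≡⟨ cong (_+ m) i∸m≡ ⟩
       s + t * m + m  ≡⟨ +-assoc s (t * m) m ⟩
       s + (t * m + m) ≡⟨ cong (s +_) (+-comm (t * m) m) ⟩
       s + suc t * m  ∎)
  where
    open ≡-Reasoning
    m≤i : m ≤ i
    m≤i = ≤-trans m≤1+k (≰⇒> i≰k)
    i∸m≤k+l*m : i ∸ m ≤ k + l * m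
    i∸m≤k+l*m = ≤-trans (∸-monoˡ-≤ m i≤) (≤-reflexive (begin
      k + (m + l * m) ∸ m  ≡⟨ cong (λ j → k + j ∸ m) (+-comm m (l * m)) ⟩
      k + (l * m + m) ∸ m  ≡⟨ cong (_∸ m) (sym (+-assoc k (l * m) m)) ⟩
      k + l * m + m ∸ m    ≡⟨ m+n∸n≡m (k + l * m) m ⟩
      k + l * m            ∎))

ap-⊕-ap : ∀ {a b d m k l} → m ≤ suc k →
          (ap a d (suc k) ⊕ ap b (m * d) (suc l)) ≐ ap (a + b) d (suc (k + l * m))
ap-⊕-ap {a} {b} {d} {m} {k} {l} m≤1+k x = mk⇔ into onto
  where
    P = ap a d (suc k)
    Q = ap b (m * d) (suc l)
    R = ap (a + b) d (suc (k + l * m))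

    regroup : ∀ s t → (a + s * d) + (b + t * (m * d)) ≡ (a + b) + (s + t * m) * d
    regroup = solve 6 (λ a b d m s t →
      (a :+ s :* d) :+ (b :+ t :* (m :* d)) := (a :+ b) :+ (s :+ t :* m) :* d) refl a b d m

    into : x ∈ P ⊕ Q → x ∈ R
    into x∈ with _ , _ , y∈ , z∈ , refl ← to (∈-⊕ P Q) x∈
            with s , s≤k , refl ← to (∈-ap a d _) y∈
               | t , t≤l , refl ← to (∈-ap b (m * d) _) z∈ =
      from (∈-ap (a + b) d _)
           (s + t * m , s≤s (+-mono-≤ (≤-pred s≤k) (*-monoˡ-≤ m (≤-pred t≤l))) , regroup s t)

    onto : x ∈ R → x ∈ P ⊕ Q
    onto x∈ with i , i<len , refl ← to (∈-ap (a + b) d _) x∈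
            with s , t , s≤k , t≤l , refl ← decompose l i m≤1+k (≤-pred i<len) =
      from (∈-⊕ P Q) ( _ , _
                     , from (∈-ap a d _) (s , s≤s s≤k , refl)
                     , from (∈-ap b (m * d) _) (t , s≤s t≤l , refl)
                     , sym (regroup s t))

^-injectiveʳ : ∀ {m a b} → 1 < m → m ^ a ≡ m ^ b → a ≡ b
^-injectiveʳ {m} {a} {b} 1<m mᵃ≡mᵇ with <-cmp a b
... | tri< a<b _ _ = contradiction mᵃ≡mᵇ (<⇒≢ (^-monoʳ-< m 1<m a<b))
... | tri≈ _ a≡b _ = a≡b
... | tri> _ _ b<a = contradiction mᵃ≡mᵇ (>⇒≢ (^-monoʳ-< m 1<m b<a))

+-⊓-injective : ∀ {a b c d} → a + b ≡ c + d → a ⊓ b ≡ c ⊓ d →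
                (a ≡ c × b ≡ d) ⊎ (a ≡ d × b ≡ c)
+-⊓-injective {a} {b} {c} {d} sum≡ min≡ with ⊓-sel a b | ⊓-sel c d
... | inj₁ p | inj₁ q with refl ← trans (sym p) (trans min≡ q) =
  inj₁ (refl , +-cancelˡ-≡ a b d sum≡)
... | inj₁ p | inj₂ q with refl ← trans (sym p) (trans min≡ q) =
  inj₂ (refl , +-cancelˡ-≡ a b c (trans sum≡ (+-comm c a)))
... | inj₂ p | inj₁ q with refl ← trans (sym p) (trans min≡ q) =
  inj₂ (+-cancelʳ-≡ b a d (trans sum≡ (+-comm b d)) , refl)
... | inj₂ p | inj₂ q with refl ← trans (sym p) (trans min≡ q) =
  inj₁ (+-cancelʳ-≡ b a c sum≡ , refl)

module Labelling (N : ℕ) where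

  K : ℕ
  K = 2 + 2 ^ N

  label : ℕ → FinSet
  label a = ap a (2 ^ a) (suc K)

  label-AP : ∀ a → APSet (label a)
  label-AP a = APSet-ap (m^n>0 2 a) (s≤s (s≤s (s≤s z≤n)))

  2^∸≤1+K : ∀ {a b} → b ≤ N → 2 ^ (b ∸ a) ≤ suc K
  2^∸≤1+K {a} {b} b≤N = ≤-trans (^-monoʳ-≤ 2 (≤-trans (m∸n≤m b a) b≤N)) (m≤n+m (2 ^ N) 3)

  2^-split : ∀ {a b} → a ≤ b → 2 ^ b ≡ 2 ^ (b ∸ a) * 2 ^ a
  2^-split {a} {b} a≤b = trans (cong (2 ^_) (sym (m∸n+n≡m a≤b))) (^-distribˡ-+-* 2 (b ∸ a) a)

  label-⊕-≤ : ∀ {a b} → a ≤ b → b ≤ N →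
              (label a ⊕ label b) ≐ ap (a + b) (2 ^ a) (suc (K + K * 2 ^ (b ∸ a)))
  label-⊕-≤ {a} {b} a≤b b≤N =
    subst (λ B → (label a ⊕ B) ≐ ap (a + b) (2 ^ a) (suc (K + K * 2 ^ (b ∸ a))))
          (cong (λ d → ap b d (suc K)) (sym (2^-split a≤b)))
          (ap-⊕-ap {a} {b} {2 ^ a} {2 ^ (b ∸ a)} (2^∸≤1+K {a} b≤N))

  label-⊕ : ∀ a b → a ≤ N → b ≤ N →
            (label a ⊕ label b) ≐ ap (a + b) (2 ^ (a ⊓ b)) (suc (K + K * 2 ^ ∣ a - b ∣))
  label-⊕ a b a≤N b≤N with ≤-total a b
  ... | inj₁ a≤b rewrite m≤n⇒m⊓n≡m a≤b | m≤n⇒∣m-n∣≡n∸m a≤b = label-⊕-≤ a≤b b≤N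
  ... | inj₂ b≤a rewrite m≥n⇒m⊓n≡n b≤a | ∣-∣-comm a b | m≤n⇒∣m-n∣≡n∸m b≤a | +-comm a b =
    ≐-trans (⊕-comm (label a) (label b)) (label-⊕-≤ b≤a a≤N)

  label-⊕-AP : ∀ {a b} → a ≤ N → b ≤ N → APSet (label a ⊕ label b)
  label-⊕-AP {a} {b} a≤N b≤N =
    APSet-≐ (label-⊕ a b a≤N b≤N) (APSet-ap (m^n>0 2 (a ⊓ b)) (s≤s (s≤s (s≤s z≤n))))

  label-injective : ∀ {a b} → label a ≐ label b → a ≡ b
  label-injective {a} {b} = start-unique (label-AP a) (label-AP b)

  -- label-⊕-AP a≤N b≤N has start a + b and diff 2 ^ (a ⊓ b) by construction.
  label-⊕-injective : ∀ {a b c d} → a ≤ N → b ≤ N → c ≤ N → d ≤ N →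
                      (label a ⊕ label b) ≐ (label c ⊕ label d) → (a ≡ c × b ≡ d) ⊎ (a ≡ d × b ≡ c)
  label-⊕-injective a≤N b≤N c≤N d≤N ab≐cd =
    +-⊓-injective (start-unique A B ab≐cd) (^-injectiveʳ (s≤s (s≤s z≤n)) (diff-unique A B ab≐cd))
    where
      A = label-⊕-AP a≤N b≤N
      B = label-⊕-AP c≤N d≤N

  label-RatioOK : ∀ {a b} → a < b → b ≤ N → RatioOK (label-AP a) (label-AP b)
  label-RatioOK {a} {b} a<b b≤N =
    2 ^ (b ∸ a) , ^-monoʳ-< 2 (s≤s (s≤s z≤n)) (m<n⇒0<n∸m a<b) , 2^∸≤1+K {a} b≤N , 2^-split (<⇒≤ a<b)

  label-RatioOK-≢ : ∀ {a b} → a ≢ b → a ≤ N → b ≤ N →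
                  RatioOK (label-AP a) (label-AP b) ⊎ RatioOK (label-AP b) (label-AP a)
  label-RatioOK-≢ {a} {b} a≢b a≤N b≤N with <-cmp a b
  ... | tri< a<b _ _ = inj₁ (label-RatioOK a<b b≤N)
  ... | tri≈ _ a≡b _ = contradiction a≡b a≢b
  ... | tri> _ _ b<a = inj₂ (label-RatioOK b<a a≤N)

proposition3p3 : (G : Graph) → NoIsolated G → ∃[ f ] IsBiarithmeticIASI G f
proposition3p3 G _ = label ∘ toℕ , record
  { iasi = record
    { nonempty = λ v → _ , start-∈ (label-AP (toℕ v))
    ; vinj = λ u v u≐v → toℕ-injective (label-injective u≐v)
    ; einj = λ u v x y _ _ uv≐xy →
        ⊎.map (×.map toℕ-injective toℕ-injective) (×.map toℕ-injective toℕ-injective)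
              (label-⊕-injective (bound u) (bound v) (bound x) (bound y) uv≐xy)
    }
  ; vAP = λ v → label-AP (toℕ v)
  ; eAP = λ u v _ → label-⊕-AP (bound u) (bound v)
  ; ratio = λ u v uv → label-RatioOK-≢ (toℕ-≢ uv) (bound u) (bound v)
  }
  where
    open Labelling (n G)
    toℕ-≢ : ∀ {u v} → Adj G u v → toℕ u ≢ toℕ v
    toℕ-≢ {u} uv u≡v = irrefl G (subst (Adj G u) (sym (toℕ-injective u≡v)) uv)
    bound : (v : Fin (n G)) → toℕ v ≤ n G
    bound v = <⇒≤ (toℕ<n v)
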